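{- Let $d\ge2$, let $m\ge0$ be an integer, let $\alpha=S_d(m)$, let $\beta\in\mathcal S_d$, and let $r\ge1$. Then $B(\beta;2^rm,2^r(m+1))$ equals the number of walks of length $r$ in $\mathcal G_d$ from $\alpha$ to $\beta$ (i.e. the $(\alpha,\beta)$ entry of $M_d^r$, where $M_d$ is the adjacency matrix of $\mathcal G_d$).
   Context: The Stern sequence $(s(n))_{n\ge0}$ is defined by $s(0)=0$, $s(1)=1$, $s(2n)=s(n)$, $s(2n+1)=s(n)+s(n+1)$. For an integer $d\ge2$, let $S_d(n)=(s(n)\bmod d,\ s(n+1)\bmod d)$ and $\mathcal S_d=\{(i\bmod d, j\bmod d): \gcd(i,j,d)=1\}$. For $\alpha=(i,j)\in\mathcal S_d$ let $L(\alpha)=(i,i+j)$ and $R(\alpha)=(i+j,j)$ (entries mod $d$). $\mathcal G_d$ is the directed graph with vertex set $\mathcal S_d$ and edges $(\alpha,L(\alpha))$ and $(\alpha,R(\alpha))$ for each $\alpha\in\mathcal S_d$ (counted with multiplicity in the adjacency matrix). For $\gamma\in\mathcal S_d$ and integers $U_1<U_2$, $B(\gamma;U_1,U_2)=|\{m: U_1\le m<U_2,\ S_d(m)=\gamma\}|$. -}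

module Defs where

open import Data.Nat using (ℕ; zero; suc; _+_; _*_; _∸_; _^_; NonZero)
open import Data.Nat.DivMod using (_/_; _%_; _mod_)
open import Data.Nat.GCD using (gcd)
open import Data.Fin using (Fin; toℕ)
import Data.Fin as F
open import Data.Product using (_×_; _,_)
open import Data.Product.Properties using (≡-dec)
open import Data.List using (List; length; filter; applyUpTo)
open import Relation.Binary.PropositionalEquality using (_≡_)
open import Relation.Nullary using (Dec; yes; no)

-- Stern's diatomic sequence, via fuel (fuel ≥ n suffices; see sternF below).
-- s(0)=0, s(1)=1, s(2n)=s(n), s(2n+1)=s(n)+s(n+1).
sternF : ℕ → ℕ → ℕ
sternF zero    _ = 0
sternF (suc f) zero = 0
sternF (suc f) (suc zero) = 1
sternF (suc f) n@(suc (suc _)) with n % 2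
... | zero  = sternF f (n / 2)
... | suc _ = sternF f (n / 2) + sternF f (suc (n / 2))

stern : ℕ → ℕ
stern n = sternF n n

Pair : ℕ → Set
Pair d = Fin d × Fin d

Sd : (d : ℕ) → .{{_ : NonZero d}} → ℕ → Pair d
Sd d n = (stern n mod d , stern (suc n) mod d)

InS : (d : ℕ) → Pair d → Set
InS d (i , j) = gcd (gcd (toℕ i) (toℕ j)) d ≡ 1

addF : (d : ℕ) → .{{_ : NonZero d}} → Fin d → Fin d → Fin d
addF d i j = (toℕ i + toℕ j) mod d

Lmap : (d : ℕ) → .{{_ : NonZero d}} → Pair d → Pair d
Lmap d (i , j) = (i , addF d i j)

Rmap : (d : ℕ) → .{{_ : NonZero d}} → Pair d → Pair d
Rmap d (i , j) = (addF d i j , j)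

_≟P_ : {d : ℕ} → (a b : Pair _) → Dec (a ≡ b)
_≟P_ {d} = ≡-dec (F._≟_ {d}) (F._≟_ {d})

-- number of walks of length r from α to β in 𝒢_d (the (α,β) entry of M_d^r):
-- a walk of length r+1 from α starts with one of the two edges α→L(α), α→R(α)
-- (counted with multiplicity).
walks : (d : ℕ) → .{{_ : NonZero d}} → ℕ → Pair d → Pair d → ℕ
walks d zero    α β with α ≟P β
... | yes _ = 1
... | no  _ = 0
walks d (suc r) α β = walks d r (Lmap d α) β + walks d r (Rmap d α) β

B : (d : ℕ) → .{{_ : NonZero d}} → Pair d → ℕ → ℕ → ℕ
B d γ U₁ U₂ = length (filter (λ m → Sd d m ≟P γ) (applyUpTo (U₁ +_) (U₂ ∸ U₁)))

{-# OPTIONS --safe #-}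
-- By the Stern recurrences, S_d(2m) = L(S_d(m)) and S_d(2m+1) = R(S_d(m)). The block
-- [2^(r+1) m, 2^(r+1) (m+1)) is the union of the level-r blocks of 2m and 2m+1, so the number
-- of hits of β in it satisfies the same recursion in r as the number of walks from S_d(m) to β.
module Submission where

open import Defs
open import Data.Nat
open import Data.Nat.Properties
open import Data.Nat.DivMod
open import Data.Nat.Divisibility using (n∣m*n)
open import Data.Fin using (toℕ)
open import Data.Fin.Properties using (toℕ-fromℕ<; toℕ-injective)
open import Data.Product using (_,_)
open import Data.List using (List; _∷_; _++_; length; filter; applyUpTo)
open import Data.List.Properties using (length-++; filter-++)
open import Function using (_∘_)
open import Relation.Nullary using (yes; no)
open import Relation.Unary using (Pred; Decidable)
open import Relation.Binary.PropositionalEquality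
  using (_≡_; _≗_; refl; sym; trans; cong; cong₂; subst; module ≡-Reasoning)
open import Data.Nat.Tactic.RingSolver using (solve-∀)

-- The case split of the clauses of sternF, with its parity test resolved.
data Shape : ℕ → Set where
  is-0    : Shape 0
  is-1    : Shape 1
  is-2+2* : ∀ j → Shape (2 + 2 * j)
  is-3+2* : ∀ j → Shape (3 + 2 * j)

shape : ∀ n → Shape n
shape 0 = is-0
shape 1 = is-1
shape (suc (suc n)) with shape n
... | is-0      = is-2+2* 0
... | is-1      = is-3+2* 0
... | is-2+2* j = subst Shape (cong (2 +_) (*-suc 2 j)) (is-2+2* (suc j))
... | is-3+2* j = subst Shape (cong (3 +_) (*-suc 2 j)) (is-3+2* (suc j))

2+2*n≡[1+n]*2 : ∀ n → 2 + 2 * n ≡ (1 + n) * 2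
2+2*n≡[1+n]*2 n = trans (sym (*-suc 2 n)) (*-comm 2 (1 + n))

[2+2*n]%2≡0 : ∀ n → (2 + 2 * n) % 2 ≡ 0
[2+2*n]%2≡0 n = trans (cong (_% 2) (2+2*n≡[1+n]*2 n)) (m*n%n≡0 (1 + n) 2)

[3+2*n]%2≡1 : ∀ n → (3 + 2 * n) % 2 ≡ 1
[3+2*n]%2≡1 n = trans (cong (λ k → suc k % 2) (2+2*n≡[1+n]*2 n)) ([m+kn]%n≡m%n 1 (1 + n) 2)

[2+2*n]/2≡1+n : ∀ n → (2 + 2 * n) / 2 ≡ 1 + n
[2+2*n]/2≡1+n n = trans (cong (_/ 2) (2+2*n≡[1+n]*2 n)) (m*n/n≡m (1 + n) 2)

[3+2*n]/2≡1+n : ∀ n → (3 + 2 * n) / 2 ≡ 1 + n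
[3+2*n]/2≡1+n n = begin
  (3 + 2 * n) / 2          ≡⟨ cong (λ k → suc k / 2) (2+2*n≡[1+n]*2 n) ⟩
  (1 + (1 + n) * 2) / 2    ≡⟨ +-distrib-/-∣ʳ 1 (n∣m*n (1 + n) {2}) ⟩
  1 / 2 + (1 + n) * 2 / 2  ≡⟨ m*n/n≡m (1 + n) 2 ⟩
  1 + n                    ∎
  where open ≡-Reasoning

sternF-0 : ∀ f → sternF f 0 ≡ 0
sternF-0 zero    = refl
sternF-0 (suc f) = refl

sternF-2+2* : ∀ f j → sternF (suc f) (2 + 2 * j) ≡ sternF f (1 + j)
sternF-2+2* f j with (2 + 2 * j) % 2 in eq
... | zero  = cong (sternF f) ([2+2*n]/2≡1+n j)
... | suc _ with () ← trans (sym eq) ([2+2*n]%2≡0 j)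

sternF-3+2* : ∀ f j → sternF (suc f) (3 + 2 * j) ≡ sternF f (1 + j) + sternF f (2 + j)
sternF-3+2* f j with (3 + 2 * j) % 2 in eq
... | zero with () ← trans (sym eq) ([3+2*n]%2≡1 j)
... | suc _ = cong (λ k → sternF f k + sternF f (suc k)) ([3+2*n]/2≡1+n j)

1+n≤1+2*n : ∀ n → 1 + n ≤ 1 + 2 * n
1+n≤1+2*n n = s≤s (m≤n*m n 2)

2+n≤2+2*n : ∀ n → 2 + n ≤ 2 + 2 * n
2+n≤2+2*n n = s≤s (1+n≤1+2*n n)

sternF-fuel-irrelevant : ∀ {f g} n → n ≤ f → n ≤ g → sternF f n ≡ sternF g n
sternF-fuel-irrelevant n n≤f n≤g with shape n
sternF-fuel-irrelevant {f} {g} _ _ _ | is-0 = trans (sternF-0 f) (sym (sternF-0 g))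
sternF-fuel-irrelevant _ (s≤s _) (s≤s _) | is-1 = refl
sternF-fuel-irrelevant {suc f} {suc g} _ (s≤s n≤f) (s≤s n≤g) | is-2+2* j = begin
  sternF (suc f) (2 + 2 * j)  ≡⟨ sternF-2+2* f j ⟩
  sternF f (1 + j)            ≡⟨ sternF-fuel-irrelevant (1 + j) (≤-trans (1+n≤1+2*n j) n≤f)
                                                                  (≤-trans (1+n≤1+2*n j) n≤g) ⟩
  sternF g (1 + j)            ≡⟨ sternF-2+2* g j ⟨
  sternF (suc g) (2 + 2 * j)  ∎
  where open ≡-Reasoning
sternF-fuel-irrelevant {suc f} {suc g} _ (s≤s n≤f) (s≤s n≤g) | is-3+2* j = begin
  sternF (suc f) (3 + 2 * j)          ≡⟨ sternF-3+2* f j ⟩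
  sternF f (1 + j) + sternF f (2 + j) ≡⟨ cong₂ _+_ (irrelevant (1 + j) (m≤n⇒m≤1+n (1+n≤1+2*n j)))
                                                   (irrelevant (2 + j) (2+n≤2+2*n j)) ⟩
  sternF g (1 + j) + sternF g (2 + j) ≡⟨ sternF-3+2* g j ⟨
  sternF (suc g) (3 + 2 * j)          ∎
  where
  open ≡-Reasoning
  irrelevant : ∀ k → k ≤ 2 + 2 * j → sternF f k ≡ sternF g k
  irrelevant k k≤ = sternF-fuel-irrelevant k (≤-trans k≤ n≤f) (≤-trans k≤ n≤g)

stern-even : ∀ n → stern (2 * n) ≡ stern n
stern-even zero    = refl
stern-even (suc j) = begin
  stern (2 * suc j)               ≡⟨ cong (λ k → sternF k k) (*-suc 2 j) ⟩
  sternF (2 + 2 * j) (2 + 2 * j)  ≡⟨ sternF-2+2* (1 + 2 * j) j ⟩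
  sternF (1 + 2 * j) (1 + j)      ≡⟨ sternF-fuel-irrelevant (1 + j) (1+n≤1+2*n j) ≤-refl ⟩
  stern (1 + j)                   ∎
  where open ≡-Reasoning

stern-odd : ∀ n → stern (1 + 2 * n) ≡ stern n + stern (1 + n)
stern-odd zero    = refl
stern-odd (suc j) = begin
  stern (1 + 2 * suc j)            ≡⟨ cong (λ k → sternF (suc k) (suc k)) (*-suc 2 j) ⟩
  sternF (3 + 2 * j) (3 + 2 * j)   ≡⟨ sternF-3+2* (2 + 2 * j) j ⟩
  sternF (2 + 2 * j) (1 + j) + sternF (2 + 2 * j) (2 + j)
    ≡⟨ cong₂ _+_ (sternF-fuel-irrelevant (1 + j) (m≤n⇒m≤1+n (1+n≤1+2*n j)) ≤-refl)
                 (sternF-fuel-irrelevant (2 + j) (2+n≤2+2*n j) ≤-refl) ⟩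
  stern (1 + j) + stern (2 + j)    ∎
  where open ≡-Reasoning

toℕ-mod : ∀ n d .{{_ : NonZero d}} → toℕ (n mod d) ≡ n % d
toℕ-mod n d = toℕ-fromℕ< _

addF-mod : ∀ d .{{_ : NonZero d}} a b → addF d (a mod d) (b mod d) ≡ (a + b) mod d
addF-mod d a b = toℕ-injective (begin
  toℕ (addF d (a mod d) (b mod d))     ≡⟨ toℕ-mod _ d ⟩
  (toℕ (a mod d) + toℕ (b mod d)) % d  ≡⟨ cong₂ (λ x y → (x + y) % d) (toℕ-mod a d) (toℕ-mod b d) ⟩
  (a % d + b % d) % d                  ≡⟨ %-distribˡ-+ a b d ⟨
  (a + b) % d                          ≡⟨ toℕ-mod (a + b) d ⟨
  toℕ ((a + b) mod d)                  ∎)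
  where open ≡-Reasoning

module _ (d : ℕ) .{{_ : NonZero d}} where

  Sd-even : ∀ m → Sd d (2 * m) ≡ Lmap d (Sd d m)
  Sd-even m = cong₂ _,_ (cong (_mod d) (stern-even m))
                        (trans (cong (_mod d) (stern-odd m)) (sym (addF-mod d _ _)))

  Sd-odd : ∀ m → Sd d (1 + 2 * m) ≡ Rmap d (Sd d m)
  Sd-odd m = cong₂ _,_ (trans (cong (_mod d) (stern-odd m)) (sym (addF-mod d _ _)))
                       (cong (_mod d) (trans (cong stern (sym (*-suc 2 m))) (stern-even (suc m))))

applyUpTo-cong : ∀ {a} {A : Set a} {f g : ℕ → A} → f ≗ g → ∀ n → applyUpTo f n ≡ applyUpTo g n
applyUpTo-cong f≗g zero    = refl
applyUpTo-cong f≗g (suc n) = cong₂ _∷_ (f≗g 0) (applyUpTo-cong (f≗g ∘ suc) n)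

applyUpTo-+ : ∀ {a} {A : Set a} (f : ℕ → A) n k →
              applyUpTo f (n + k) ≡ applyUpTo f n ++ applyUpTo (f ∘ (n +_)) k
applyUpTo-+ f zero    k = refl
applyUpTo-+ f (suc n) k = cong (f 0 ∷_) (applyUpTo-+ (f ∘ suc) n k)

module _ {p} {P : Pred ℕ p} (P? : Decidable P) where

  countFrom : ℕ → ℕ → ℕ
  countFrom a n = length (filter P? (applyUpTo (a +_) n))

  countFrom-+ : ∀ a n k → countFrom a (n + k) ≡ countFrom a n + countFrom (a + n) k
  countFrom-+ a n k = begin
    length (filter P? (applyUpTo (a +_) (n + k)))
      ≡⟨ cong (length ∘ filter P?) (applyUpTo-+ (a +_) n k) ⟩
    length (filter P? (applyUpTo (a +_) n ++ shifted))
      ≡⟨ cong length (filter-++ P? (applyUpTo (a +_) n) shifted) ⟩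
    length (filter P? (applyUpTo (a +_) n) ++ filter P? shifted)
      ≡⟨ length-++ (filter P? (applyUpTo (a +_) n)) ⟩
    countFrom a n + length (filter P? shifted)
      ≡⟨ cong (λ xs → countFrom a n + length (filter P? xs)) (applyUpTo-cong (sym ∘ +-assoc a n) k) ⟩
    countFrom a n + countFrom (a + n) k ∎
    where
    open ≡-Reasoning
    shifted : List ℕ
    shifted = applyUpTo (λ i → a + (n + i)) k

2*p*m≡p*[2*m] : ∀ p m → 2 * p * m ≡ p * (2 * m)
2*p*m≡p*[2*m] = solve-∀

p*[2*m]+p≡p*[1+2*m] : ∀ p m → p * (2 * m) + p ≡ p * (1 + 2 * m)
p*[2*m]+p≡p*[1+2*m] = solve-∀

module _ (d : ℕ) .{{_ : NonZero d}} (β : Pair d) where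

  hits : ℕ → ℕ → ℕ
  hits = countFrom (λ m → Sd d m ≟P β)

  hits-singleton : ∀ a → hits a 1 ≡ walks d 0 (Sd d a) β
  hits-singleton a rewrite +-identityʳ a with Sd d a ≟P β
  ... | yes _ = refl
  ... | no  _ = refl

  hits-block : ∀ r m → hits (2 ^ r * m) (2 ^ r) ≡ walks d r (Sd d m) β
  hits-block zero    m = trans (cong (λ a → hits a 1) (*-identityˡ m)) (hits-singleton m)
  hits-block (suc r) m = begin
    hits (2 * p * m) (2 * p)                   ≡⟨ cong₂ hits (2*p*m≡p*[2*m] p m) (cong (p +_) (+-identityʳ p)) ⟩
    hits (p * (2 * m)) (p + p)                 ≡⟨ countFrom-+ _ (p * (2 * m)) p p ⟩
    hits (p * (2 * m)) p + hits (p * (2 * m) + p) p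
                                               ≡⟨ cong (λ a → hits (p * (2 * m)) p + hits a p) (p*[2*m]+p≡p*[1+2*m] p m) ⟩
    hits (p * (2 * m)) p + hits (p * (1 + 2 * m)) p
                                               ≡⟨ cong₂ _+_ (hits-block r (2 * m)) (hits-block r (1 + 2 * m)) ⟩
    walks d r (Sd d (2 * m)) β + walks d r (Sd d (1 + 2 * m)) β
                                               ≡⟨ cong₂ (λ α α′ → walks d r α β + walks d r α′ β) (Sd-even d m) (Sd-odd d m) ⟩
    walks d (suc r) (Sd d m) β                 ∎
    where
    open ≡-Reasoning
    p : ℕ
    p = 2 ^ r

m*[1+n]∸m*n≡m : ∀ m n → m * suc n ∸ m * n ≡ m
m*[1+n]∸m*n≡m m n = trans (cong (_∸ m * n) (*-suc m n)) (m+n∸n≡m m (m * n))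

lemma4p4 : (d : ℕ) → .{{_ : NonZero d}} → 2 ≤ d → (m : ℕ) → (β : Pair d) → InS d β →
    (r : ℕ) → 1 ≤ r →
    B d β (2 ^ r * m) (2 ^ r * suc m) ≡ walks d r (Sd d m) β
lemma4p4 d _ m β _ r _ = begin
  B d β (2 ^ r * m) (2 ^ r * suc m)                 ≡⟨⟩
  hits d β (2 ^ r * m) (2 ^ r * suc m ∸ 2 ^ r * m)  ≡⟨ cong (hits d β (2 ^ r * m)) (m*[1+n]∸m*n≡m (2 ^ r) m) ⟩
  hits d β (2 ^ r * m) (2 ^ r)                      ≡⟨ hits-block d β r m ⟩
  walks d r (Sd d m) β                              ∎
  where open ≡-Reasoning
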